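{- Let $p$ be an odd prime and $r\ge1$ an integer. The least period of the sequence $(H_{r-1}(u))_{u\ge0}$ is $p^{r+1}$.
   Context: Let $\varphi$ be Euler's totient function. For an integer $r\ge1$, the Euler quotient $Q_r(u)$ is the unique integer with $0\le Q_r(u)<p^r$ and $Q_r(u)\equiv \frac{u^{\varphi(p^r)}-1}{p^r}\pmod{p^r}$ when $\gcd(u,p)=1$; and $Q_r(u)=0$ when $p\mid u$. One has $Q_r(u)\equiv Q_{r-1}(u)\pmod{p^{r-1}}$ for $r\ge2$. Define $H_0(u)=Q_1(u)$ and, for $r\ge2$, $H_{r-1}(u)$ as the unique integer with $0\le H_{r-1}(u)<p$ and $H_{r-1}(u)\equiv \frac{Q_r(u)-Q_{r-1}(u)}{p^{r-1}}\pmod p$ (the highest $p$-adic digit of $Q_r(u)$). -}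

module Defs where

open import Data.Nat using (ℕ; zero; suc; _+_; _*_; _∸_; _^_; _≤_; NonZero)
open import Data.Nat.Properties using (m^n≢0)
open import Data.Nat.DivMod using (_/_; _%_)
open import Data.Nat.Coprimality using (Coprime; coprime?)
open import Data.List using (List; length; filter; map; upTo)
open import Data.Product using (_×_)
open import Relation.Nullary using (yes; no)
open import Relation.Binary.PropositionalEquality using (_≡_)

φ : ℕ → ℕ
φ n = length (filter (λ k → coprime? k n) (map suc (upTo n)))

-- Euler quotient Q_r(u) (r ≥ 1 intended), for the modulus p
Q : (p : ℕ) .{{_ : NonZero p}} → ℕ → ℕ → ℕ
Q p r u with coprime? u p
... | yes _ = _%_ (_/_ ((u ^ φ (p ^ r)) ∸ 1) (p ^ r) {{m^n≢0 p r}}) (p ^ r) {{m^n≢0 p r}}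
... | no  _ = 0

H : (p : ℕ) .{{_ : NonZero p}} → ℕ → ℕ → ℕ
H p zero    u = Q p 1 u
H p (suc k) u = _/_ (Q p (suc (suc k)) u ∸ Q p (suc k) u) (p ^ suc k) {{m^n≢0 p (suc k)}} % p

IsPeriod : (ℕ → ℕ) → ℕ → Set
IsPeriod f T = (1 ≤ T) × (∀ u → f (u + T) ≡ f u)

LeastPeriod : (ℕ → ℕ) → ℕ → Set
LeastPeriod f T = IsPeriod f T × (∀ T′ → IsPeriod f T′ → T ≤ T′)

{-# OPTIONS --safe #-}
module Submission where

-- For u prime to p, Q_{d+1}(u) is the second base-p^{d+1} digit of u^φ − 1, φ = φ(p^{d+1}).
-- As φ = p^d (p − 1), the binomial theorem gives (u + p^{d+2})^φ ≡ u^φ mod p^{2d+2}, so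
-- Q_{d+1}, and with it H_s, has period p^{s+2}. Periods are closed under gcd, so a period
-- T < p^{s+2} would make p^{s+1} a period; but H_s(1) = 0 while H_s(1 + p^{s+1}) = p − 1.

open import Defs
open import Data.Nat
open import Data.Nat.Properties
open import Data.Nat.Divisibility
open import Data.Nat.DivMod
open import Data.Nat.GCD using (gcd; gcd-GCD; gcd[m,n]∣m; gcd[m,n]∣n; module Bézout)
open import Data.Nat.Coprimality using (Coprime; coprime?; coprime-divisor; 1-coprimeTo; ¬0-coprimeTo-2+)
open import Data.Nat.Primality
open import Data.Nat.Tactic.RingSolver using (solve-∀)
open import Data.List using ([]; _∷_; _++_; length; filter; map; upTo)
open import Data.List.Properties using (map-++; length-++; filter-++; filter-accept; filter-reject; upTo-∷ʳ)
open import Data.Product using (∃-syntax; _,_; proj₁; proj₂)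
open import Data.Sum using (_⊎_; inj₁; inj₂)
open import Data.Empty using (⊥-elim)
open import Function using (_∘_)
open import Level using (0ℓ)
open import Relation.Nullary using (¬_; Dec; yes; no)
open import Relation.Unary using (Pred; Decidable)
open import Relation.Binary.PropositionalEquality

Periodic : (ℕ → ℕ) → ℕ → Set
Periodic f T = ∀ u → f (u + T) ≡ f u

module _ {f : ℕ → ℕ} where

  periodic-* : ∀ {T} → Periodic f T → ∀ k → Periodic f (k * T)
  periodic-* per zero    u = cong f (+-identityʳ u)
  periodic-* {T} per (suc k) u = begin
    f (u + (T + k * T))  ≡⟨ cong (f ∘ (u +_)) (+-comm T (k * T)) ⟩
    f (u + (k * T + T))  ≡⟨ cong f (+-assoc u (k * T) T) ⟨
    f (u + k * T + T)    ≡⟨ per (u + k * T) ⟩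
    f (u + k * T)        ≡⟨ periodic-* per k u ⟩
    f u                  ∎
    where open ≡-Reasoning

  periodic-∣ : ∀ {T S} → Periodic f T → T ∣ S → Periodic f S
  periodic-∣ per (divides k refl) = periodic-* per k

  periodic-+-* : ∀ {A B g} → Periodic f A → Periodic f B → ∀ a b → g + a * A ≡ b * B →
                 Periodic f g
  periodic-+-* {A} {B} {g} perA perB a b eq u = begin
    f (u + g)          ≡⟨ periodic-* perA a (u + g) ⟨
    f (u + g + a * A)  ≡⟨ cong f (trans (+-assoc u g (a * A)) (cong (u +_) eq)) ⟩
    f (u + b * B)      ≡⟨ periodic-* perB b u ⟩
    f u                ∎
    where open ≡-Reasoning

  periodic-gcd : ∀ {T P} → Periodic f T → Periodic f P → Periodic f (gcd T P)
  periodic-gcd {T} {P} perT perP with Bézout.identity (gcd-GCD T P)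
  ... | Bézout.+- x y eq = periodic-+-* perP perT y x eq
  ... | Bézout.-+ x y eq = periodic-+-* perT perP x y eq

module _ {p : ℕ} (p-prime : Prime p) where

  private instance
    p-nonZero : NonZero p
    p-nonZero = prime⇒nonZero p-prime
    p-nonTrivial : NonTrivial p
    p-nonTrivial = prime⇒nonTrivial p-prime

  ∤⇒coprime : ∀ {k} → ¬ p ∣ k → Coprime k p
  ∤⇒coprime p∤k (d∣k , d∣p) with prime⇒irreducible p-prime d∣p
  ... | inj₁ d≡1  = d≡1
  ... | inj₂ refl = ⊥-elim (p∤k d∣k)

  coprime⇒∤ : ∀ {k} → Coprime k p → ¬ p ∣ k
  coprime⇒∤ k⊥p p∣k = nonTrivial⇒≢1 (k⊥p (p∣k , ∣-refl))

  coprime-+p* : ∀ {u} X → Coprime u p → Coprime (u + p * X) p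
  coprime-+p* {u} X u⊥p = ∤⇒coprime λ p∣u+pX →
    coprime⇒∤ u⊥p (∣m+n∣m⇒∣n (subst (p ∣_) (+-comm u (p * X)) p∣u+pX) (m∣m*n X))

  coprime-+p*⁻¹ : ∀ {u} X → Coprime (u + p * X) p → Coprime u p
  coprime-+p*⁻¹ X u+pX⊥p = ∤⇒coprime λ p∣u → coprime⇒∤ u+pX⊥p (∣m∣n⇒∣m+n p∣u (m∣m*n X))

  ∤⇒coprime-^ : ∀ n {k} → ¬ p ∣ k → Coprime k (p ^ n)
  ∤⇒coprime-^ zero    _   (_ , d∣1) = ∣1⇒≡1 d∣1
  ∤⇒coprime-^ (suc n) p∤k (d∣k , d∣p^[1+n]) =
    ∤⇒coprime-^ n p∤k (d∣k , coprime-divisor d⊥p d∣p^[1+n])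
    where d⊥p = ∤⇒coprime (p∤k ∘ λ p∣d → ∣-trans p∣d d∣k)

  coprime-^⇒∤ : ∀ n {k} → Coprime k (p ^ suc n) → ¬ p ∣ k
  coprime-^⇒∤ n k⊥p^[1+n] p∣k = nonTrivial⇒≢1 (k⊥p^[1+n] (p∣k , m∣m*n (p ^ n)))

  ∣p^[1+n]⇒≡∨∣p^n : ∀ n {d} → d ∣ p ^ suc n → d ≡ p ^ suc n ⊎ d ∣ p ^ n
  ∣p^[1+n]⇒≡∨∣p^n n {d} d∣p^[1+n] with p ∣? d
  ... | no  p∤d = inj₂ (coprime-divisor (∤⇒coprime p∤d) d∣p^[1+n])
  ... | yes (divides q refl) =
    multiple n (*-cancelʳ-∣ p (subst (q * p ∣_) (*-comm p (p ^ n)) d∣p^[1+n]))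
    where
    multiple : ∀ k → q ∣ p ^ k → q * p ≡ p ^ suc k ⊎ q * p ∣ p ^ k
    multiple zero    q∣1 = inj₁ (trans (cong (_* p) (∣1⇒≡1 q∣1)) (*-comm 1 p))
    multiple (suc k) q∣p^[1+k] with ∣p^[1+n]⇒≡∨∣p^n k q∣p^[1+k]
    ... | inj₁ refl  = inj₁ (*-comm (p ^ suc k) p)
    ... | inj₂ q∣p^k = inj₂ (subst (q * p ∣_) (*-comm (p ^ k) p) (*-monoˡ-∣ p q∣p^k))

  leastPeriod-p^[1+n] : ∀ {f} n → Periodic f (p ^ suc n) → ¬ Periodic f (p ^ n) →
                        LeastPeriod f (p ^ suc n)
  leastPeriod-p^[1+n] {f} n perP ¬perp^n = (m^n>0 p (suc n) , perP) , least
    where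
    least : ∀ T → IsPeriod f T → p ^ suc n ≤ T
    least T (T≥1 , perT) with ∣p^[1+n]⇒≡∨∣p^n n (gcd[m,n]∣n T (p ^ suc n))
    ... | inj₁ g≡p^[1+n] = ∣⇒≤ {{>-nonZero T≥1}} (subst (_∣ T) g≡p^[1+n] (gcd[m,n]∣m T _))
    ... | inj₂ g∣p^n     = ⊥-elim (¬perp^n (periodic-∣ (periodic-gcd perT perP) g∣p^n))

module Count {P : Pred ℕ 0ℓ} (P? : Decidable P) where

  count : ℕ → ℕ
  count n = length (filter P? (map suc (upTo n)))

  count-suc : ∀ n → count (suc n) ≡ count n + length (filter P? (suc n ∷ []))
  count-suc n = begin
    length (filter P? (map suc (upTo (suc n))))
      ≡⟨ cong (length ∘ filter P? ∘ map suc) (upTo-∷ʳ n) ⟨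
    length (filter P? (map suc (upTo n ++ n ∷ [])))
      ≡⟨ cong (length ∘ filter P?) (map-++ suc (upTo n) (n ∷ [])) ⟩
    length (filter P? (map suc (upTo n) ++ suc n ∷ []))
      ≡⟨ cong length (filter-++ P? (map suc (upTo n)) (suc n ∷ [])) ⟩
    length (filter P? (map suc (upTo n)) ++ filter P? (suc n ∷ []))
      ≡⟨ length-++ (filter P? (map suc (upTo n))) ⟩
    count n + length (filter P? (suc n ∷ []))
      ∎
    where open ≡-Reasoning

  count-accept : ∀ {n} → P (suc n) → count (suc n) ≡ suc (count n)
  count-accept {n} Pn = trans (count-suc n)
    (trans (cong (λ xs → count n + length xs) (filter-accept P? Pn)) (+-comm (count n) 1))

  count-reject : ∀ {n} → ¬ P (suc n) → count (suc n) ≡ count n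
  count-reject {n} ¬Pn = trans (count-suc n)
    (trans (cong (λ xs → count n + length xs) (filter-reject P? ¬Pn)) (+-identityʳ (count n)))

  module _ {m : ℕ} (accept : ∀ {k} → ¬ suc m ∣ k → P k)
                  (reject : ∀ {k} → suc m ∣ k → ¬ P k) where

    count-run : ∀ q j → j ≤ m → count (q * suc m + j) ≡ count (q * suc m) + j
    count-run q zero    _ = trans (cong count (+-identityʳ (q * suc m))) (sym (+-identityʳ _))
    count-run q (suc j) j<m = begin
      count (q * suc m + suc j)    ≡⟨ cong count (+-suc (q * suc m) j) ⟩
      count (suc (q * suc m + j))  ≡⟨ count-accept (accept ∤) ⟩
      suc (count (q * suc m + j))  ≡⟨ cong suc (count-run q j (<⇒≤ j<m)) ⟩
      suc (count (q * suc m) + j)  ≡⟨ +-suc (count (q * suc m)) j ⟨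
      count (q * suc m) + suc j    ∎
      where
      open ≡-Reasoning
      ∤ : ¬ suc m ∣ suc (q * suc m + j)
      ∤ m+1∣ = <⇒≱ (s≤s j<m)
        (∣⇒≤ (∣m+n∣m⇒∣n (subst (suc m ∣_) (sym (+-suc (q * suc m) j)) m+1∣) (n∣m*n q)))

    count-multiple : ∀ q → count (q * suc m) ≡ q * m
    count-multiple zero    = refl
    count-multiple (suc q) = begin
      count (suc q * suc m)        ≡⟨ cong count [1+q][1+m] ⟨
      count (suc (q * suc m + m))  ≡⟨ count-reject (reject (divides (suc q) [1+q][1+m])) ⟩
      count (q * suc m + m)        ≡⟨ count-run q m ≤-refl ⟩
      count (q * suc m) + m        ≡⟨ cong (_+ m) (count-multiple q) ⟩
      q * m + m                    ≡⟨ +-comm (q * m) m ⟩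
      suc q * m                    ∎
      where
      open ≡-Reasoning
      [1+q][1+m] : suc (q * suc m + m) ≡ suc q * suc m
      [1+q][1+m] = cong suc (+-comm (q * suc m) m)

^-+-expansion : ∀ a b n → ∃[ c ] (a + b) ^ n ≡ a ^ n + (n * a ^ (n ∸ 1) + c * b) * b
^-+-expansion a b zero    = 0 , refl
^-+-expansion a b (suc n) = expansion n
  where
  expansion : ∀ n → ∃[ c ] (a + b) ^ suc n ≡ a ^ suc n + (suc n * a ^ n + c * b) * b
  expansion zero    = 0 , base a b
    where
    base : ∀ a b → (a + b) * 1 ≡ a * 1 + (1 * 1 + 0 * b) * b
    base = solve-∀
  expansion (suc n) with c , eq ← expansion n =
    c * a + suc n * a ^ n + c * b , trans (cong ((a + b) *_) eq) (step a b c n (a ^ n))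
    where
    step : ∀ a b c n A → (a + b) * (a * A + ((1 + n) * A + c * b) * b)
           ≡ a * (a * A) + ((2 + n) * (a * A) + (c * a + (1 + n) * A + c * b) * b) * b
    step = solve-∀

secondDigit : (M : ℕ) .{{_ : NonZero M}} → ℕ → ℕ
secondDigit M x = (x ∸ 1) / M % M

module _ (M : ℕ) .{{_ : NonZero M}} where

  secondDigit-+M² : ∀ {x} k → 1 ≤ x → secondDigit M (x + k * (M * M)) ≡ secondDigit M x
  secondDigit-+M² {suc y} k _ = begin
    (y + k * (M * M)) / M % M        ≡⟨ cong (_% M) (+-distrib-/-∣ʳ y M∣kMM) ⟩
    (y / M + k * (M * M) / M) % M    ≡⟨ cong (λ z → (y / M + z) % M) kMM/M≡kM ⟩
    (y / M + k * M) % M              ≡⟨ [m+kn]%n≡m%n (y / M) k M ⟩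
    y / M % M                        ∎
    where
    open ≡-Reasoning
    M∣kMM : M ∣ k * (M * M)
    M∣kMM = divides (k * M) (sym (*-assoc k M M))
    kMM/M≡kM : k * (M * M) / M ≡ k * M
    kMM/M≡kM = trans (cong (_/ M) (sym (*-assoc k M M))) (m*n/n≡m (k * M) M)

  secondDigit-[1+M]^ : ∀ n → secondDigit M ((1 + M) ^ n) ≡ n % M
  secondDigit-[1+M]^ n with c , eq ← ^-+-expansion 1 M n = begin
    secondDigit M ((1 + M) ^ n)
      ≡⟨ cong (secondDigit M) eq ⟩
    secondDigit M (1 ^ n + (n * 1 ^ (n ∸ 1) + c * M) * M)
      ≡⟨ cong₂ (λ x y → secondDigit M (x + (n * y + c * M) * M)) (^-zeroˡ n) (^-zeroˡ (n ∸ 1)) ⟩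
    (n * 1 + c * M) * M / M % M
      ≡⟨ cong (_% M) (m*n/n≡m (n * 1 + c * M) M) ⟩
    (n * 1 + c * M) % M
      ≡⟨ [m+kn]%n≡m%n (n * 1) c M ⟩
    n * 1 % M
      ≡⟨ cong (_% M) (*-identityʳ n) ⟩
    n % M
      ∎
    where open ≡-Reasoning

  secondDigit-1 : secondDigit M 1 ≡ 0
  secondDigit-1 = trans (cong (_% M) (0/n≡0 M)) (m*n%n≡0 0 M)

module EulerQuotient {m : ℕ} (p-prime : Prime (suc m)) where

  private
    p : ℕ
    p = suc m
    instance
      p-nonTrivial : NonTrivial p
      p-nonTrivial = prime⇒nonTrivial p-prime

  Q-coprime : ∀ r {u} → Coprime u p → Q p r u ≡ secondDigit (p ^ r) {{m^n≢0 p r}} (u ^ φ (p ^ r))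
  Q-coprime r {u} u⊥p with coprime? u p
  ... | yes _     = refl
  ... | no ¬u⊥p   = ⊥-elim (¬u⊥p u⊥p)

  Q-¬coprime : ∀ r {u} → ¬ Coprime u p → Q p r u ≡ 0
  Q-¬coprime r {u} ¬u⊥p with coprime? u p
  ... | yes u⊥p = ⊥-elim (¬u⊥p u⊥p)
  ... | no _    = refl

  -- φ n unfolds to Count.count (λ k → coprime? k n) n.
  φ-p^[1+d] : ∀ d → φ (p ^ suc d) ≡ p ^ d * m
  φ-p^[1+d] d = trans (cong count (*-comm p (p ^ d))) (count-multiple accept reject (p ^ d))
    where
    open Count (λ k → coprime? k (p ^ suc d))
    accept : ∀ {k} → ¬ p ∣ k → Coprime k (p ^ suc d)
    accept = ∤⇒coprime-^ p-prime (suc d)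
    reject : ∀ {k} → p ∣ k → ¬ Coprime k (p ^ suc d)
    reject p∣k k⊥p^[1+d] = coprime-^⇒∤ p-prime d k⊥p^[1+d] p∣k

  [u+p^[2+d]]^φ : ∀ d u → ∃[ k ] (u + p ^ suc (suc d)) ^ φ (p ^ suc d)
                                 ≡ u ^ φ (p ^ suc d) + k * (p ^ suc d * p ^ suc d)
  [u+p^[2+d]]^φ d u with c , eq ← ^-+-expansion u (p ^ suc (suc d)) (φ (p ^ suc d)) =
    m * A + c * p * p , (begin
      (u + b) ^ n
        ≡⟨ eq ⟩
      u ^ n + (n * A + c * b) * b
        ≡⟨ cong (λ n′ → u ^ n + (n′ * A + c * b) * b) (φ-p^[1+d] d) ⟩
      u ^ n + (p ^ d * m * A + c * b) * b
        ≡⟨ cong (u ^ n +_) (regroup (p ^ d) m A c p) ⟩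
      u ^ n + (m * A + c * p * p) * (p ^ suc d * p ^ suc d)
        ∎)
    where
    open ≡-Reasoning
    b = p ^ suc (suc d)
    n = φ (p ^ suc d)
    A = u ^ (n ∸ 1)
    regroup : ∀ X m A c p → (X * m * A + c * (p * (p * X))) * (p * (p * X))
              ≡ (m * A + c * p * p) * ((p * X) * (p * X))
    regroup = solve-∀

  Q-periodic : ∀ d → Periodic (Q p (suc d)) (p ^ suc (suc d))
  Q-periodic d u = by-cases (coprime? u p)
    where
    M = p ^ suc d
    instance
      M-nonZero : NonZero M
      M-nonZero = m^n≢0 p (suc d)
    ^-positive : ∀ {u} → Coprime u p → 1 ≤ u ^ φ M
    ^-positive {zero}  0⊥p = ⊥-elim (¬0-coprimeTo-2+ 0⊥p)
    ^-positive {suc u} _   = m^n>0 (suc u) (φ M)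
    by-cases : Dec (Coprime u p) → Q p (suc d) (u + p ^ suc (suc d)) ≡ Q p (suc d) u
    by-cases (no ¬u⊥p) = trans (Q-¬coprime (suc d) (¬u⊥p ∘ coprime-+p*⁻¹ p-prime M))
                               (sym (Q-¬coprime (suc d) ¬u⊥p))
    by-cases (yes u⊥p) = begin
      Q p (suc d) (u + p ^ suc (suc d))
        ≡⟨ Q-coprime (suc d) (coprime-+p* p-prime M u⊥p) ⟩
      secondDigit M ((u + p ^ suc (suc d)) ^ φ M)    ≡⟨ cong (secondDigit M) eq ⟩
      secondDigit M (u ^ φ M + k * (M * M))          ≡⟨ secondDigit-+M² M k (^-positive u⊥p) ⟩
      secondDigit M (u ^ φ M)                        ≡⟨ Q-coprime (suc d) u⊥p ⟨
      Q p (suc d) u                                  ∎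
      where
      open ≡-Reasoning
      k = proj₁ ([u+p^[2+d]]^φ d u)
      eq = proj₂ ([u+p^[2+d]]^φ d u)

  Q-at-1 : ∀ r → Q p r 1 ≡ 0
  Q-at-1 r = begin
    Q p r 1                                ≡⟨ Q-coprime r (1-coprimeTo p) ⟩
    secondDigit (p ^ r) (1 ^ φ (p ^ r))    ≡⟨ cong (secondDigit (p ^ r)) (^-zeroˡ (φ (p ^ r))) ⟩
    secondDigit (p ^ r) 1                  ≡⟨ secondDigit-1 (p ^ r) ⟩
    0                                      ∎
    where
    open ≡-Reasoning
    instance
      p^r-nonZero : NonZero (p ^ r)
      p^r-nonZero = m^n≢0 p r

  Q-at-1+p^[1+d] : ∀ d → Q p (suc d) (1 + p ^ suc d) ≡ p ^ d * m
  Q-at-1+p^[1+d] d = begin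
    Q p (suc d) (1 + M)               ≡⟨ Q-coprime (suc d) (coprime-+p* p-prime (p ^ d) (1-coprimeTo p)) ⟩
    secondDigit M ((1 + M) ^ φ M)     ≡⟨ secondDigit-[1+M]^ M (φ M) ⟩
    φ M % M                           ≡⟨ cong (_% M) (φ-p^[1+d] d) ⟩
    p ^ d * m % M                     ≡⟨ m<n⇒m%n≡m p^d*m<M ⟩
    p ^ d * m                         ∎
    where
    open ≡-Reasoning
    M = p ^ suc d
    instance
      M-nonZero : NonZero M
      M-nonZero = m^n≢0 p (suc d)
      p^d-nonZero : NonZero (p ^ d)
      p^d-nonZero = m^n≢0 p d
    p^d*m<M : p ^ d * m < M
    p^d*m<M = subst (p ^ d * m <_) (*-comm (p ^ d) p) (*-monoʳ-< (p ^ d) ≤-refl)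

  H-periodic : ∀ s → Periodic (H p s) (p ^ suc (suc s))
  H-periodic zero    = Q-periodic 0
  H-periodic (suc k) u =
    cong₂ (λ a b → (a ∸ b) / p ^ suc k % p) (Q-periodic (suc k) u) (periodic-* (Q-periodic k) p u)
    where
    instance
      p^[1+k]-nonZero : NonZero (p ^ suc k)
      p^[1+k]-nonZero = m^n≢0 p (suc k)

  H-at-1 : ∀ s → H p s 1 ≡ 0
  H-at-1 zero    = Q-at-1 1
  H-at-1 (suc k) = begin
    (Q p (suc (suc k)) 1 ∸ Q p (suc k) 1) / p ^ suc k % p
      ≡⟨ cong₂ (λ a b → (a ∸ b) / p ^ suc k % p) (Q-at-1 (suc (suc k))) (Q-at-1 (suc k)) ⟩
    0 / p ^ suc k % p
      ≡⟨ cong (_% p) (0/n≡0 (p ^ suc k)) ⟩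
    0
      ∎
    where
    open ≡-Reasoning
    instance
      p^[1+k]-nonZero : NonZero (p ^ suc k)
      p^[1+k]-nonZero = m^n≢0 p (suc k)

  H-at-1+p^[1+s] : ∀ s → H p s (1 + p ^ suc s) ≡ m
  H-at-1+p^[1+s] zero    = trans (Q-at-1+p^[1+d] 0) (*-identityˡ m)
  H-at-1+p^[1+s] (suc k) = begin
    (Q p (suc (suc k)) (1 + M) ∸ Q p (suc k) (1 + M)) / p ^ suc k % p
      ≡⟨ cong₂ (λ a b → (a ∸ b) / p ^ suc k % p) (Q-at-1+p^[1+d] (suc k)) Q-at-1+M ⟩
    p ^ suc k * m / p ^ suc k % p
      ≡⟨ cong (λ x → x / p ^ suc k % p) (*-comm (p ^ suc k) m) ⟩
    m * p ^ suc k / p ^ suc k % p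
      ≡⟨ cong (_% p) (m*n/n≡m m (p ^ suc k)) ⟩
    m % p
      ≡⟨ m<n⇒m%n≡m ≤-refl ⟩
    m ∎
    where
    open ≡-Reasoning
    M = p ^ suc (suc k)
    instance
      p^[1+k]-nonZero : NonZero (p ^ suc k)
      p^[1+k]-nonZero = m^n≢0 p (suc k)
    Q-at-1+M : Q p (suc k) (1 + M) ≡ 0
    Q-at-1+M = trans (Q-periodic k 1) (Q-at-1 (suc k))

theorem2 : (p : ℕ) (pp : Prime p) → ¬ (2 ∣ p) → (r : ℕ) → 1 ≤ r →
    LeastPeriod (H p {{prime⇒nonZero pp}} (r ∸ 1)) (p ^ (r + 1))
theorem2 zero    pp _ _       _  = ⊥-elim (NonZero.nonZero (prime⇒nonZero pp))
theorem2 (suc m) pp _ (suc s) _  =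
  subst (LeastPeriod (H p s) ∘ (p ^_)) (+-comm 1 (suc s))
    (leastPeriod-p^[1+n] pp (suc s) (H-periodic s) ¬periodic)
  where
  open EulerQuotient pp
  p = suc m
  ¬periodic : ¬ Periodic (H p s) (p ^ suc s)
  ¬periodic per = nonTrivial⇒≢1 {{prime⇒nonTrivial pp}} (cong suc (begin
    m                    ≡⟨ H-at-1+p^[1+s] s ⟨
    H p s (1 + p ^ suc s) ≡⟨ per 1 ⟩
    H p s 1              ≡⟨ H-at-1 s ⟩
    0                    ∎))
    where open ≡-Reasoning
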